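{- For nonnegative integers $n$ and $k$, let $a_{n,k}$ denote the number of semistandard Young tableaux with $n$ cells whose entries lie in $\{1,\dots,k\}$. Then the sequence $(a_{n,k})_{k\in\mathbb{N}}$ is in general not log-concave: there exists $n$ (for instance $n=45$, where $a_{45,2}^2=304704<307970=a_{45,1}\cdot a_{45,3}$) such that $a_{n,k-1}a_{n,k+1}>a_{n,k}^2$ for some $k\ge 1$.
   Context: A semistandard Young tableau on $k$ symbols of shape $\lambda$ (a Ferrers diagram) is a filling of the cells of $\lambda$ with integers in $\{1,\dots,k\}$ (not necessarily all used) such that entries are strictly increasing along rows and weakly increasing down columns. A sequence $(s_i)_{i\in\mathbb{N}}$ is log-concave if $s_{i-1}s_{i+1}\le s_i^2$ for every $i>0$. -}

module Defs where

open import Data.Nat using (ℕ; _≤_; _<_)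
open import Data.Fin using (Fin)
import Data.Fin as F
open import Data.List using (List; []; _∷_; length; map)
open import Data.Nat.ListAction using (sum)
open import Data.List.Relation.Unary.All using (All)
open import Data.List.Relation.Unary.Linked using (Linked)
open import Data.Product using (Σ; _×_)
open import Data.Unit using (⊤)
open import Data.Empty using (⊥)
open import Relation.Binary.PropositionalEquality using (_≡_)
open import Function.Bundles using (_↔_)

-- A tableau is stored as the list of its rows (top row first); each row is
-- the list of its entries from left to right.  Entries in {1,…,k} are
-- represented by Fin k (value i+1 ↦ i : Fin k).

ColWeak : ∀ {k} → List (Fin k) → List (Fin k) → Set
ColWeak r        []       = ⊤
ColWeak []       (y ∷ ys) = ⊥
ColWeak (x ∷ xs) (y ∷ ys) = (x F.≤ y) × ColWeak xs ys

-- T is a semistandard Young tableau (in the paper's convention: strictly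
-- increasing along rows, weakly increasing down columns) with n cells and
-- entries in {1,…,k}, whose shape is a Ferrers diagram (nonempty rows of
-- weakly decreasing length).
record IsSSYT (n k : ℕ) (T : List (List (Fin k))) : Set where
  field
    rowsNonempty : All (λ r → 0 < length r) T
    shape        : Linked (λ r s → length s ≤ length r) T
    rowsStrict   : All (Linked F._<_) T
    colsWeak     : Linked ColWeak T
    cells        : sum (map length T) ≡ n

SSYT : ℕ → ℕ → Set
SSYT n k = Σ (List (List (Fin k))) (IsSSYT n k)

HasCard : Set → ℕ → Set
HasCard A m = A ↔ Fin m

IsA : ℕ → ℕ → ℕ → Set
IsA n k m = HasCard (SSYT n k) m

module Submission where

-- A row of a tableau with entries in {1,…,k} is a strictly increasing list,
-- i.e. a subset of {1,…,k}, and a tableau is a chain of nonempty rows each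
-- fitting under the previous one.  Splitting off the first row gives the
-- recurrence: the tableaux with n cells hanging below a row u correspond to a
-- choice of a row v fitting under u together with a tableau of n − |v| cells
-- hanging below v.  Enumerating the finitely many rows for each k turns this
-- into an explicit counting function, proved correct by exhibiting each step
-- of the recurrence as a bijection; it evaluates to a_{45,1} = 1,
-- a_{45,2} = 552 and a_{45,3} = 307970, and 552² = 304704 < 307970.

open import Defs
open import Data.Nat using (ℕ; _*_; _<_; _≤_; _∸_; suc)
open import Data.Product using (Σ; _×_)

open import Data.Nat using (zero; _+_; z≤n; s≤s; s≤s⁻¹; _≤?_; _<?_)
open import Data.Nat.Properties
  using ( ≤-irrelevant; ≡-irrelevant; m+n≡0⇒m≡0; m≤m+n; m+n∸m≡n; m+[n∸m]≡n; <-irrefl; ∸-monoʳ-<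
        ; +-0-monoid)
open import Data.Nat.Induction using (<-rec)
open import Data.Nat.ListAction using (sum)
open import Algebra.Properties.Monoid.Sum +-0-monoid using () renaming (sum to ∑)
open import Data.Bool using (if_then_else_)
open import Data.Fin using (Fin; zero; suc)
import Data.Fin as F
import Data.Fin.Properties as FP
open import Data.Fin.Properties using (+↔⊎)
open import Data.List using (List; []; _∷_; _++_; length; map; lookup)
open import Data.List.Properties using (map-∘; map-injective; ∷-injectiveʳ)
open import Data.List.Relation.Unary.All as All using (All; []; _∷_)
open import Data.List.Relation.Unary.All.Properties using (gmap⁺; map⁺; ++⁺)
open import Data.List.Relation.Unary.Any as Any using (here)
open import Data.List.Relation.Unary.Any.Properties using (lookup-index)
open import Data.List.Relation.Unary.Linked as Linked using (Linked; []; [-]; _∷_)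
open import Data.List.Relation.Unary.Linked.Properties using (Linked⇒All)
import Data.List.Relation.Unary.Linked.Properties as Linkedₚ
open import Data.List.Relation.Unary.Unique.Propositional using (Unique)
import Data.List.Relation.Unary.Unique.Propositional.Properties as Uniqueₚ
open import Data.List.Relation.Unary.AllPairs using ([]; _∷_)
open import Data.List.Membership.Propositional using (_∈_)
open import Data.List.Membership.Propositional.Properties using (∈-lookup; ∈-map⁺; ∈-map⁻; ∈-++⁺ˡ; ∈-++⁺ʳ)
open import Data.Vec using (Vec; tabulate; replicate)
import Data.Vec as Vec
open import Data.Vec.Properties using (lookup∘tabulate; lookup-replicate)
open import Data.Maybe using (Maybe; just; nothing)
open import Data.Sum using (_⊎_; inj₁; inj₂; [_,_])
open import Data.Sum.Function.Propositional using (_⊎-↔_)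
open import Data.Unit using (⊤; tt)
open import Data.Empty using (⊥-elim)
open import Data.Product using (_,_; proj₁; proj₂)
open import Function using (_∘_)
open import Function.Bundles using (_↔_; mk↔ₛ′)
open import Function.Properties.Inverse using (↔-sym; ↔-trans)
open import Function.Related.Propositional using (module EquationalReasoning)
open import Relation.Binary.PropositionalEquality using (_≡_; _≢_; refl; sym; trans; cong; cong₂; subst)
open import Relation.Nullary using (Dec; yes; no; ¬_; Irrelevant)
open import Relation.Nullary.Decidable using (⌊_⌋; _×-dec_; from-yes)

Σ-Fin-suc↔ : ∀ {r} {B : Fin (suc r) → Set} → Σ (Fin (suc r)) B ↔ (B zero ⊎ Σ (Fin r) (B ∘ suc))
Σ-Fin-suc↔ = mk↔ₛ′
  (λ { (zero , b) → inj₁ b ; (suc j , b) → inj₂ (j , b) })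
  [ zero ,_ , (λ (j , b) → suc j , b) ]
  (λ { (inj₁ _) → refl ; (inj₂ _) → refl })
  (λ { (zero , _) → refl ; (suc _ , _) → refl })

Σ-Fin↔∑ : ∀ {r} {B : Fin r → Set} (c : Fin r → ℕ) → (∀ j → B j ↔ Fin (c j)) →
          Σ (Fin r) B ↔ Fin (∑ c)
Σ-Fin↔∑ {zero} c e = mk↔ₛ′ (λ { (() , _) }) (λ ()) (λ ()) (λ { (() , _) })
Σ-Fin↔∑ {suc r} {B} c e = begin
  Σ (Fin (suc r)) B                     ↔⟨ Σ-Fin-suc↔ ⟩
  (B zero ⊎ Σ (Fin r) (B ∘ suc))        ↔⟨ e zero ⊎-↔ Σ-Fin↔∑ (c ∘ suc) (e ∘ suc) ⟩
  (Fin (c zero) ⊎ Fin (∑ (c ∘ suc)))    ↔⟨ ↔-sym +↔⊎ ⟩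
  Fin (∑ c)                             ∎
  where open EquationalReasoning

Σ-≡-irrelevant : ∀ {A : Set} {B : A → Set} → (∀ {x} → Irrelevant (B x)) →
                 ∀ {x y} {p : B x} {q : B y} → x ≡ y → (x , p) ≡ (y , q)
Σ-≡-irrelevant irr refl = cong (_ ,_) (irr _ _)

↔-Fin-cast : ∀ {X : Set} {a b} → a ≡ b → X ↔ Fin a → X ↔ Fin b
↔-Fin-cast refl e = e

guarded↔ : ∀ {P X : Set} {x} (P? : Dec P) → Irrelevant P → (P → X ↔ Fin x) →
           (P × X) ↔ Fin (if ⌊ P? ⌋ then x else 0)
guarded↔ (yes p) irr e =
  ↔-trans (mk↔ₛ′ proj₂ (p ,_) (λ _ → refl) (λ (q , _) → cong (_, _) (irr p q))) (e p)
guarded↔ (no ¬p) irr e = mk↔ₛ′ (λ (p , _) → ⊥-elim (¬p p)) (λ ()) (λ ()) (λ (p , _) → ⊥-elim (¬p p))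

Strict : ∀ {k} → List (Fin k) → Set
Strict = Linked F._<_

strictLists : ∀ k → List (List (Fin k))
strictLists zero    = [] ∷ []
strictLists (suc k) = shifted ++ map (zero ∷_) shifted
  where shifted = map (map suc) (strictLists k)

map-suc-strict : ∀ {k} {l : List (Fin k)} → Strict l → Strict (map suc l)
map-suc-strict = Linkedₚ.map⁺ ∘ Linked.map s≤s

map-suc-strict⁻ : ∀ {k} {l : List (Fin k)} → Strict (map suc l) → Strict l
map-suc-strict⁻ = Linked.map s≤s⁻¹ ∘ Linkedₚ.map⁻

zero∷-strict : ∀ {k} {l : List (Fin k)} → Strict l → Strict (zero ∷ map suc l)
zero∷-strict {l = []}    _ = [-]
zero∷-strict {l = _ ∷ _} s = s≤s z≤n ∷ map-suc-strict s

strictLists-strict : ∀ k → All Strict (strictLists k)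
strictLists-strict zero    = [] ∷ []
strictLists-strict (suc k) = ++⁺ (gmap⁺ map-suc-strict ss) (map⁺ (gmap⁺ zero∷-strict ss))
  where ss = strictLists-strict k

head<tail : ∀ {k} {x : Fin k} {t} → Strict (x ∷ t) → All (x F.<_) t
head<tail [-]     = []
head<tail (p ∷ s) = Linked⇒All FP.<-trans p s

unshift : ∀ {k} {l : List (Fin (suc k))} → All (zero {k} F.<_) l → Σ (List (Fin k)) λ l′ → map suc l′ ≡ l
unshift [] = [] , refl
unshift {l = suc y ∷ _} (_ ∷ p) with unshift p
... | t , refl = y ∷ t , refl

mutual
  ∈-strictLists : ∀ {k} {l : List (Fin k)} → Strict l → l ∈ strictLists k
  ∈-strictLists {zero}  {[]}        _ = here refl
  ∈-strictLists {suc k} {[]}        s = ∈-++⁺ˡ (∈-shifted [] s)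
  ∈-strictLists {suc k} {zero ∷ t}  s = ∈-++⁺ʳ _ (∈-map⁺ (zero ∷_) (∈-shifted (head<tail s) (Linked.tail s)))
  ∈-strictLists {suc k} {suc x ∷ t} s = ∈-++⁺ˡ (∈-shifted (Linked⇒All FP.<-trans (s≤s z≤n) s) s)

  ∈-shifted : ∀ {k} {l : List (Fin (suc k))} → All (zero {k} F.<_) l → Strict l →
              l ∈ map (map suc) (strictLists k)
  ∈-shifted p s with unshift p
  ... | l′ , refl = ∈-map⁺ (map suc) (∈-strictLists (map-suc-strict⁻ s))

map-suc≢zero∷ : ∀ {k} (l : List (Fin k)) {w : List (Fin (suc k))} → map suc l ≢ zero ∷ w
map-suc≢zero∷ []      ()
map-suc≢zero∷ (_ ∷ _) ()

strictLists-unique : ∀ k → Unique (strictLists k)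
strictLists-unique zero    = [] ∷ []
strictLists-unique (suc k) = Uniqueₚ.++⁺ u (Uniqueₚ.map⁺ ∷-injectiveʳ u) disjoint
  where
  u = Uniqueₚ.map⁺ (map-injective FP.suc-injective) (strictLists-unique k)
  disjoint : ∀ {v} → ¬ (v ∈ map (map suc) (strictLists k) × v ∈ map (zero ∷_) (map (map suc) (strictLists k)))
  disjoint (v∈ , v∈′) with ∈-map⁻ (map suc) v∈ | ∈-map⁻ (zero ∷_) v∈′
  ... | l , _ , v≡ | _ , _ , v≡′ = map-suc≢zero∷ l (trans (sym v≡) v≡′)

lookup-injective : ∀ {A : Set} {xs : List A} → Unique xs → ∀ {i j} → lookup xs i ≡ lookup xs j → i ≡ j
lookup-injective (_  ∷ _) {zero}  {zero}  _ = refl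
lookup-injective (x∉ ∷ _) {zero}  {suc j} e = ⊥-elim (All.lookup x∉ (∈-lookup j) e)
lookup-injective (x∉ ∷ _) {suc i} {zero}  e = ⊥-elim (All.lookup x∉ (∈-lookup i) (sym e))
lookup-injective (_  ∷ u) {suc i} {suc j} e = cong suc (lookup-injective u e)

colWeak? : ∀ {k} (u v : List (Fin k)) → Dec (ColWeak u v)
colWeak? u       []      = yes tt
colWeak? []      (_ ∷ _) = no λ ()
colWeak? (x ∷ u) (y ∷ v) = x FP.≤? y ×-dec colWeak? u v

colWeak-irrelevant : ∀ {k} (u v : List (Fin k)) → Irrelevant (ColWeak u v)
colWeak-irrelevant u       []      tt      tt        = refl
colWeak-irrelevant (x ∷ u) (y ∷ v) (p , q) (p′ , q′) =
  cong₂ _,_ (≤-irrelevant p p′) (colWeak-irrelevant u v q q′)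

IsSSYT-irrelevant : ∀ {n k T} → Irrelevant (IsSSYT n k T)
IsSSYT-irrelevant record { rowsNonempty = a ; shape = b ; rowsStrict = c ; colsWeak = d ; cells = e }
                  record { rowsNonempty = a′ ; shape = b′ ; rowsStrict = c′ ; colsWeak = d′ ; cells = e′ }
  rewrite All.irrelevant ≤-irrelevant a a′
        | Linked.irrelevant ≤-irrelevant b b′
        | All.irrelevant (Linked.irrelevant ≤-irrelevant) c c′
        | Linked.irrelevant (λ {u} {v} → colWeak-irrelevant u v) d d′
        | ≡-irrelevant e e′
  = refl

SSYT-≡ : ∀ {n k} {T T′ : List (List (Fin k))} {p : IsSSYT n k T} {q : IsSSYT n k T′} →
         T ≡ T′ → _≡_ {A = SSYT n k} (T , p) (T′ , q)
SSYT-≡ = Σ-≡-irrelevant IsSSYT-irrelevant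

module Counting (k : ℕ) where

  r : ℕ
  r = length (strictLists k)

  row : Fin r → List (Fin k)
  row = lookup (strictLists k)

  len : Fin r → ℕ
  len j = length (row j)

  row-strict : ∀ j → Strict (row j)
  row-strict j = All.lookup (strictLists-strict k) (∈-lookup j)

  index : ∀ {l : List (Fin k)} → Strict l → Fin r
  index s = Any.index (∈-strictLists s)

  row-index : ∀ {l : List (Fin k)} (s : Strict l) → row (index s) ≡ l
  row-index s = sym (lookup-index (∈-strictLists s))

  index-row : ∀ j (s : Strict (row j)) → index s ≡ j
  index-row j s = lookup-injective (strictLists-unique k) (row-index s)

  Above : List (Fin k) → List (Fin k) → Set
  Above u v = length v ≤ length u × ColWeak u v

  -- A tableau is encoded by the list of indices of its rows; `nothing` is the
  -- position above the first row, which imposes no constraint.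
  Fits : Maybe (Fin r) → Fin r → Set
  Fits nothing  j = 0 < len j
  Fits (just i) j = 0 < len j × Above (row i) (row j)

  fits? : ∀ m j → Dec (Fits m j)
  fits? nothing  j = 0 <? len j
  fits? (just i) j = 0 <? len j ×-dec (len j ≤? len i ×-dec colWeak? (row i) (row j))

  fits-irrelevant : ∀ m j → Irrelevant (Fits m j)
  fits-irrelevant nothing  j = ≤-irrelevant
  fits-irrelevant (just i) j (a , b , c) (a′ , b′ , c′) =
    cong₂ _,_ (≤-irrelevant a a′) (cong₂ _,_ (≤-irrelevant b b′) (colWeak-irrelevant (row i) (row j) c c′))

  fits⇒nonempty : ∀ m j → Fits m j → 0 < len j
  fits⇒nonempty nothing  j f = f
  fits⇒nonempty (just i) j f = proj₁ f

  Chain : Maybe (Fin r) → List (Fin r) → Set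
  Chain m []       = ⊤
  Chain m (j ∷ js) = Fits m j × Chain (just j) js

  chain-irrelevant : ∀ m js → Irrelevant (Chain m js)
  chain-irrelevant m []       tt       tt         = refl
  chain-irrelevant m (j ∷ js) (f , c) (f′ , c′) =
    cong₂ _,_ (fits-irrelevant m j f f′) (chain-irrelevant (just j) js c c′)

  cells : List (Fin r) → ℕ
  cells js = sum (map len js)

  Chains : Maybe (Fin r) → ℕ → Set
  Chains m n = Σ (List (Fin r)) λ js → Chain m js × cells js ≡ n

  Chains-≡ : ∀ {m n js js′} {p : Chain m js × cells js ≡ n} {q : Chain m js′ × cells js′ ≡ n} →
             js ≡ js′ → _≡_ {A = Chains m n} (js , p) (js′ , q)
  Chains-≡ = Σ-≡-irrelevant λ (c , e) (c′ , e′) → cong₂ _,_ (chain-irrelevant _ _ c c′) (≡-irrelevant e e′)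

  NonEmpty : List (Fin k) → Set
  NonEmpty u = 0 < length u

  chain-just⇒ : ∀ i js → Chain (just i) js → All NonEmpty (map row js) × Linked Above (row i ∷ map row js)
  chain-just⇒ i []       _              = [] , [-]
  chain-just⇒ i (j ∷ js) ((ne , a) , c) = let nes , l = chain-just⇒ j js c in ne ∷ nes , a ∷ l

  chain-just⇐ : ∀ i js → All NonEmpty (map row js) → Linked Above (row i ∷ map row js) → Chain (just i) js
  chain-just⇐ i []       _          _       = tt
  chain-just⇐ i (j ∷ js) (ne ∷ nes) (a ∷ l) = (ne , a) , chain-just⇐ j js nes l

  chain⇒ : ∀ js → Chain nothing js → All NonEmpty (map row js) × Linked Above (map row js)
  chain⇒ []       _        = [] , []
  chain⇒ (j ∷ js) (ne , c) = let nes , l = chain-just⇒ j js c in ne ∷ nes , l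

  chain⇐ : ∀ js → All NonEmpty (map row js) → Linked Above (map row js) → Chain nothing js
  chain⇐ []       _          _ = tt
  chain⇐ (j ∷ js) (ne ∷ nes) l = ne , chain-just⇐ j js nes l

  cells-map-row : ∀ js → sum (map length (map row js)) ≡ cells js
  cells-map-row js = cong sum (sym (map-∘ js))

  isSSYT⇒chain : ∀ {n} js → IsSSYT n k (map row js) → Chain nothing js × cells js ≡ n
  isSSYT⇒chain js p =
    chain⇐ js (IsSSYT.rowsNonempty p) (Linked.zip (IsSSYT.shape p , IsSSYT.colsWeak p)) ,
    trans (sym (cells-map-row js)) (IsSSYT.cells p)

  chain⇒isSSYT : ∀ {n} js → Chain nothing js → cells js ≡ n → IsSSYT n k (map row js)
  chain⇒isSSYT js c e = record
    { rowsNonempty = proj₁ (chain⇒ js c)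
    ; shape        = proj₁ (Linked.unzip (proj₂ (chain⇒ js c)))
    ; rowsStrict   = map⁺ (All.universal row-strict js)
    ; colsWeak     = proj₂ (Linked.unzip (proj₂ (chain⇒ js c)))
    ; cells        = trans (cells-map-row js) e
    }

  indices : ∀ {T : List (List (Fin k))} → All Strict T → List (Fin r)
  indices = All.reduce index

  map-row-indices : ∀ {T} (s : All Strict T) → map row (indices s) ≡ T
  map-row-indices []       = refl
  map-row-indices (s ∷ ss) = cong₂ _∷_ (row-index s) (map-row-indices ss)

  indices-map-row : ∀ js (s : All Strict (map row js)) → indices s ≡ js
  indices-map-row []       []       = refl
  indices-map-row (j ∷ js) (s ∷ ss) = cong₂ _∷_ (index-row j s) (indices-map-row js ss)

  SSYT↔Chains : ∀ n → SSYT n k ↔ Chains nothing n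
  SSYT↔Chains n = mk↔ₛ′ to from
    (λ (js , _) → Chains-≡ (indices-map-row js _))
    (λ (T , p) → SSYT-≡ (map-row-indices _))
    where
    to : SSYT n k → Chains nothing n
    to (T , p) = indices ss , isSSYT⇒chain (indices ss) (subst (IsSSYT n k) (sym (map-row-indices ss)) p)
      where ss = IsSSYT.rowsStrict p
    from : Chains nothing n → SSYT n k
    from (js , c , e) = map row js , chain⇒isSSYT js c e

  Chains-zero : ∀ m → Chains m 0 ↔ Fin 1
  Chains-zero m = mk↔ₛ′ (λ _ → zero) (λ _ → [] , tt , refl) (λ { zero → refl }) from∘to
    where
    from∘to : ∀ c → ([] , tt , refl) ≡ c
    from∘to ([]     , _)           = Chains-≡ refl
    from∘to (j ∷ js , (f , _) , e) = ⊥-elim (<-irrefl (sym (m+n≡0⇒m≡0 (len j) e)) (fits⇒nonempty m j f))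

  FirstRow : Maybe (Fin r) → ℕ → Fin r → Set
  FirstRow m n j = Fits m j × len j ≤ suc n

  firstRow? : ∀ m n j → Dec (FirstRow m n j)
  firstRow? m n j = fits? m j ×-dec len j ≤? suc n

  Chains-suc : ∀ m n → Chains m (suc n) ↔ Σ (Fin r) λ j → FirstRow m n j × Chains (just j) (suc n ∸ len j)
  Chains-suc m n = mk↔ₛ′ to from to∘from (λ { (_ ∷ _ , _) → Chains-≡ refl })
    where
    to : Chains m (suc n) → Σ (Fin r) λ j → FirstRow m n j × Chains (just j) (suc n ∸ len j)
    to (j ∷ js , (f , c) , e) =
      j , (f , subst (len j ≤_) e (m≤m+n (len j) (cells js))) ,
      js , c , trans (sym (m+n∸m≡n (len j) (cells js))) (cong (_∸ len j) e)
    from : (Σ (Fin r) λ j → FirstRow m n j × Chains (just j) (suc n ∸ len j)) → Chains m (suc n)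
    from (j , (f , le) , js , c , e) = j ∷ js , (f , c) , trans (cong (len j +_) e) (m+[n∸m]≡n le)
    to∘from : ∀ x → to (from x) ≡ x
    to∘from (j , (f , le) , _) =
      cong (j ,_) (cong₂ _,_ (cong₂ _,_ (fits-irrelevant m j _ f) (≤-irrelevant _ le)) (Chains-≡ refl))

  at : List (Vec ℕ r) → ℕ → Fin r → ℕ
  at []       _       _ = 0
  at (v ∷ _)  zero    j = Vec.lookup v j
  at (_ ∷ vs) (suc d) j = at vs d j

  sumFirstRows : (Fin r → ℕ) → ℕ → Maybe (Fin r) → ℕ
  sumFirstRows c n m = ∑ λ j → if ⌊ firstRow? m n j ⌋ then c j else 0

  -- In tables n = [below n, below (n ∸ 1), …, below 0] the entry for
  -- suc n ∸ len j cells sits at position len j ∸ 1.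
  remaining : List (Vec ℕ r) → Fin r → ℕ
  remaining h j = at h (len j ∸ 1) j

  -- The history is an argument of extend so that evaluation shares it rather
  -- than recomputing it for every entry.
  extend : ℕ → List (Vec ℕ r) → List (Vec ℕ r)
  extend n h = tabulate (sumFirstRows (remaining h) n ∘ just) ∷ h

  tables : ℕ → List (Vec ℕ r)
  tables zero    = replicate r 1 ∷ []
  tables (suc n) = extend n (tables n)

  below : ℕ → Fin r → ℕ
  below n = at (tables n) 0

  count : ℕ → ℕ
  count zero    = 1
  count (suc n) = sumFirstRows (remaining (tables n)) n nothing

  at-tables : ∀ d p j → at (tables (d + p)) d j ≡ below p j
  at-tables zero    p j = refl
  at-tables (suc d) p j = at-tables d p j

  remaining-below : ∀ n j → 0 < len j → len j ≤ suc n → remaining (tables n) j ≡ below (suc n ∸ len j) j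
  remaining-below n j ne le with len j
  ... | suc l = subst (λ N → at (tables N) l j ≡ below (n ∸ l) j) (m+[n∸m]≡n (s≤s⁻¹ le))
                      (at-tables l (n ∸ l) j)

  sumFirstRows↔ : ∀ m n →
    (∀ j → FirstRow m n j → Chains (just j) (suc n ∸ len j) ↔ Fin (remaining (tables n) j)) →
          Chains m (suc n) ↔ Fin (sumFirstRows (remaining (tables n)) n m)
  sumFirstRows↔ m n e = ↔-trans (Chains-suc m n)
    (Σ-Fin↔∑ _ λ j → guarded↔ (firstRow? m n j) (firstRow-irrelevant j) (e j))
    where
    firstRow-irrelevant : ∀ j → Irrelevant (FirstRow m n j)
    firstRow-irrelevant j (f , le) (f′ , le′) = cong₂ _,_ (fits-irrelevant m j f f′) (≤-irrelevant le le′)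

  below↔ : ∀ n i → Chains (just i) n ↔ Fin (below n i)
  below↔ = <-rec _ go
    where
    go : ∀ n → (∀ {p} → p < n → ∀ i → Chains (just i) p ↔ Fin (below p i)) →
         ∀ i → Chains (just i) n ↔ Fin (below n i)
    go zero    _   i = ↔-Fin-cast (sym (lookup-replicate i 1)) (Chains-zero (just i))
    go (suc n) rec i = ↔-Fin-cast (sym (lookup∘tabulate (sumFirstRows (remaining (tables n)) n ∘ just) i))
      (sumFirstRows↔ (just i) n λ j (f , le) →
        let ne = fits⇒nonempty (just i) j f in
        ↔-Fin-cast (sym (remaining-below n j ne le))
          (rec (∸-monoʳ-< ne le) j))

  count↔ : ∀ n → Chains nothing n ↔ Fin (count n)
  count↔ zero    = Chains-zero nothing
  count↔ (suc n) = sumFirstRows↔ nothing n λ j (ne , le) →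
    ↔-Fin-cast (sym (remaining-below n j ne le)) (below↔ (suc n ∸ len j) j)

  ssyt-count : ∀ n → IsA n k (count n)
  ssyt-count n = ↔-trans (SSYT↔Chains n) (count↔ n)

proposition2 : Σ ℕ λ n → Σ ℕ λ k → 1 ≤ k × Σ ℕ λ a₋ → Σ ℕ λ a₀ → Σ ℕ λ a₊ → IsA n (k ∸ 1) a₋ × IsA n k a₀ × IsA n (suc k) a₊ × a₀ * a₀ < a₋ * a₊
proposition2 = 45 , 2 , s≤s z≤n , 1 , 552 , 307970 ,
  Counting.ssyt-count 1 45 , Counting.ssyt-count 2 45 , Counting.ssyt-count 3 45 , from-yes (552 * 552 <? 1 * 307970)
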